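{- Let $x_1,\dots,x_p$ be real numbers with $x_1+\dots+x_p=k$, and let $s\ge1$. For $\vec i=(i_1,\dots,i_s)\in[p]^s$ define $$\mathrm{product}_{\mathcal X}(i_1,\dots,i_s)=\prod_{j=1}^s\left(x_{i_j}-n(\vec i,j)\right),\qquad n(\vec i,j)=\left|\{m\le j: i_m=i_j\}\right|.$$ Then $$\sum_{(i_1,\dots,i_s)\in[p]^s}\mathrm{product}_{\mathcal X}(i_1,\dots,i_s)=(k-p)(k-p-1)\cdots(k-p-(s-1)).$$
   Context: $[p]=\{1,\dots,p\}$ and $\mathcal X=\{x_1,\dots,x_p\}$. -}

module Defs where

open import Level using (Level)
open import Algebra.Bundles using (CommutativeRing)
open import Data.Nat as ℕ using (ℕ; zero; suc)
open import Data.Fin using (Fin; toℕ; _≟_)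
open import Data.List using (List; []; _∷_; [_]; map; concatMap; filter; length; foldr; allFin)
open import Data.Vec using (Vec; lookup) renaming ([] to []ᵥ; _∷_ to _∷ᵥ_)
open import Relation.Nullary.Decidable using (_×-dec_)

-- All tuples (i₁,…,iₛ) ∈ [p]^s, as vectors of length s over Fin p
-- (the index set [p] = {1,…,p} is represented by Fin p = {0,…,p-1}).
tuples : (p s : ℕ) → List (Vec (Fin p) s)
tuples p zero    = [ []ᵥ ]
tuples p (suc s) = concatMap (λ i → map (i ∷ᵥ_) (tuples p s)) (allFin p)

nCount : {p s : ℕ} → Vec (Fin p) s → Fin s → ℕ
nCount {s = s} v j =
  length (filter (λ m → (toℕ m ℕ.≤? toℕ j) ×-dec (lookup v m ≟ lookup v j)) (allFin s))

module _ {c ℓ : Level} (R : CommutativeRing c ℓ) where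
  open CommutativeRing R

  fromℕ : ℕ → Carrier
  fromℕ zero    = 0#
  fromℕ (suc n) = 1# + fromℕ n

  sumR : List Carrier → Carrier
  sumR = foldr _+_ 0#

  prodR : List Carrier → Carrier
  prodR = foldr _*_ 1#

  productX : {p s : ℕ} → (Fin p → Carrier) → Vec (Fin p) s → Carrier
  productX {s = s} x v = prodR (map (λ j → x (lookup v j) - fromℕ (nCount v j)) (allFin s))

  falling : Carrier → ℕ → Carrier
  falling a s = prodR (map (λ t → a - fromℕ (toℕ t)) (allFin s))

-- Split the sum according to the first index i = i₁.  The first factor is x_i − 1, and in
-- every later factor the occurrence i₁ = i is counted exactly when i_j = i; so the remaining
-- factors form product_{X'} for the family X' obtained from X by replacing x_i with x_i − 1.
-- The entries of X' sum to k − 1, hence by induction on s the inner sum is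
-- (k − 1 − p)(k − 2 − p)⋯(k − s − p), independently of i, and summing x_i − 1 over i
-- contributes the remaining factor k − p.
module Submission where

open import Defs
open import Algebra.Bundles using (CommutativeRing)
open import Data.Nat using (ℕ; _≤_)
open import Data.Fin using (Fin)
open import Data.List using (map; allFin)

open import Level using (Level)
open import Data.Nat using (zero; suc; s≤s; s≤s⁻¹; _≤?_)
open import Data.Fin as Fin using (toℕ; _≟_)
open import Data.List.Base using (List; []; _∷_; _++_; length; filter; concatMap; tabulate)
open import Data.List.Properties
  using (map-tabulate; map-++; map-∘; length-tabulate; filter-≐; filter-none)
open import Data.List.Relation.Unary.All as All using ()
open import Data.Product.Base using (_×_; _,_; map₁)
open import Data.Vec.Base using (Vec; lookup) renaming (_∷_ to _∷ᵥ_)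
open import Data.Bool.Base using (true; false; if_then_else_)
open import Function.Base using (_∘_; id)
open import Relation.Nullary using (Dec; does; yes; no; contradiction)
open import Relation.Nullary.Decidable using (_×-dec_)
open import Relation.Unary using (Pred; Decidable)
open import Relation.Binary.PropositionalEquality as ≡ using (_≡_)
import Algebra.Properties.Ring as RingProperties
import Algebra.Properties.CommutativeSemigroup as CommutativeSemigroupProperties
import Relation.Binary.Reasoning.Setoid as SetoidReasoning

map-allFin-suc : ∀ {a} {A : Set a} {n} (f : Fin (suc n) → A) →
  map f (allFin (suc n)) ≡ f Fin.zero ∷ map (f ∘ Fin.suc) (allFin n)
map-allFin-suc f =
  ≡.cong (f Fin.zero ∷_) (≡.trans (map-tabulate Fin.suc f) (≡.sym (map-tabulate id (f ∘ Fin.suc))))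

length-filter-map : ∀ {a b p} {A : Set a} {B : Set b} {P : Pred B p}
  (P? : Decidable P) (f : A → B) (xs : List A) →
  length (filter P? (map f xs)) ≡ length (filter (P? ∘ f) xs)
length-filter-map P? f []       = ≡.refl
length-filter-map P? f (x ∷ xs) with does (P? (f x))
... | true  = ≡.cong suc (length-filter-map P? f xs)
... | false = length-filter-map P? f xs

length-filter-tabulate-suc : ∀ {p n} {P : Pred (Fin (suc n)) p} (P? : Decidable P) →
  length (filter P? (tabulate Fin.suc)) ≡ length (filter (P? ∘ Fin.suc) (allFin n))
length-filter-tabulate-suc {n = n} P? = ≡.trans
  (≡.cong (length ∘ filter P?) (≡.sym (map-tabulate id Fin.suc)))
  (length-filter-map P? Fin.suc (allFin n))

earlierOccurrence? : ∀ {p n} (w : Vec (Fin p) n) (j m : Fin n) →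
  Dec (toℕ m ≤ toℕ j × lookup w m ≡ lookup w j)
earlierOccurrence? w j m = (toℕ m ≤? toℕ j) ×-dec (lookup w m ≟ lookup w j)

module _ {p s : ℕ} (i : Fin p) (v : Vec (Fin p) s) where

  nCount-cons-zero : nCount (i ∷ᵥ v) Fin.zero ≡ 1
  nCount-cons-zero with i ≟ i
  ... | no i≢i = contradiction ≡.refl i≢i
  ... | yes _  = ≡.cong suc (≡.trans
    (length-filter-tabulate-suc (earlierOccurrence? (i ∷ᵥ v) Fin.zero))
    (≡.cong length (filter-none _ (All.universal (λ _ ()) (allFin s)))))

  nCount-cons-suc-tail : ∀ j →
    length (filter (earlierOccurrence? (i ∷ᵥ v) (Fin.suc j)) (tabulate Fin.suc)) ≡ nCount v j
  nCount-cons-suc-tail j = ≡.trans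
    (length-filter-tabulate-suc (earlierOccurrence? (i ∷ᵥ v) (Fin.suc j)))
    (≡.cong length (filter-≐ _ (earlierOccurrence? v j) (map₁ s≤s⁻¹ , map₁ s≤s) (allFin s)))

  nCount-cons-suc : ∀ j → nCount (i ∷ᵥ v) (Fin.suc j) ≡
    (if does (i ≟ lookup v j) then suc (nCount v j) else nCount v j)
  nCount-cons-suc j with does (i ≟ lookup v j)
  ... | true  = ≡.cong suc (nCount-cons-suc-tail j)
  ... | false = nCount-cons-suc-tail j

module _ {c ℓ : Level} (R : CommutativeRing c ℓ) where
  open CommutativeRing R
  open RingProperties ring using (-0#≈0#; -‿+-comm)
  open CommutativeSemigroupProperties +-commutativeSemigroup using (interchange; xy∙z≈xz∙y)
  open SetoidReasoning setoid

  sumR-cong : ∀ {a} {A : Set a} {f g : A → Carrier} → (∀ z → f z ≈ g z) →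
    ∀ xs → sumR R (map f xs) ≈ sumR R (map g xs)
  sumR-cong f≈g []       = refl
  sumR-cong f≈g (z ∷ xs) = +-cong (f≈g z) (sumR-cong f≈g xs)

  prodR-cong : ∀ {a} {A : Set a} {f g : A → Carrier} → (∀ z → f z ≈ g z) →
    ∀ xs → prodR R (map f xs) ≈ prodR R (map g xs)
  prodR-cong f≈g []       = refl
  prodR-cong f≈g (z ∷ xs) = *-cong (f≈g z) (prodR-cong f≈g xs)

  sumR-++ : ∀ xs ys → sumR R (xs ++ ys) ≈ sumR R xs + sumR R ys
  sumR-++ []       ys = sym (+-identityˡ _)
  sumR-++ (z ∷ xs) ys = trans (+-congˡ (sumR-++ xs ys)) (sym (+-assoc _ _ _))

  sumR-concatMap : ∀ {a b} {A : Set a} {B : Set b} (h : B → Carrier) (f : A → List B) xs →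
    sumR R (map h (concatMap f xs)) ≈ sumR R (map (λ z → sumR R (map h (f z))) xs)
  sumR-concatMap h f []       = refl
  sumR-concatMap h f (z ∷ xs) = begin
    sumR R (map h (f z ++ concatMap f xs))         ≡⟨ ≡.cong (sumR R) (map-++ h (f z) (concatMap f xs)) ⟩
    sumR R (map h (f z) ++ map h (concatMap f xs)) ≈⟨ sumR-++ (map h (f z)) _ ⟩
    _                                              ≈⟨ +-congˡ (sumR-concatMap h f xs) ⟩
    _                                              ∎

  sumR-*ˡ : ∀ {a} {A : Set a} k (f : A → Carrier) xs →
    sumR R (map (λ z → k * f z) xs) ≈ k * sumR R (map f xs)
  sumR-*ˡ k f []       = sym (zeroʳ k)
  sumR-*ˡ k f (z ∷ xs) = trans (+-congˡ (sumR-*ˡ k f xs)) (sym (distribˡ k _ _))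

  sumR-*ʳ : ∀ {a} {A : Set a} k (f : A → Carrier) xs →
    sumR R (map (λ z → f z * k) xs) ≈ sumR R (map f xs) * k
  sumR-*ʳ k f []       = sym (zeroˡ k)
  sumR-*ʳ k f (z ∷ xs) = trans (+-congˡ (sumR-*ʳ k f xs)) (sym (distribʳ k _ _))

  sumR-map-+ : ∀ {a} {A : Set a} (f g : A → Carrier) xs →
    sumR R (map (λ z → f z + g z) xs) ≈ sumR R (map f xs) + sumR R (map g xs)
  sumR-map-+ f g []       = sym (+-identityˡ 0#)
  sumR-map-+ f g (z ∷ xs) = trans (+-congˡ (sumR-map-+ f g xs)) (interchange _ _ _ _)

  sumR-map-neg : ∀ {a} {A : Set a} (f : A → Carrier) xs →
    sumR R (map (λ z → - f z) xs) ≈ - sumR R (map f xs)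
  sumR-map-neg f []       = sym -0#≈0#
  sumR-map-neg f (z ∷ xs) = trans (+-congˡ (sumR-map-neg f xs)) (-‿+-comm _ _)

  sumR-map-minus : ∀ {a} {A : Set a} (f g : A → Carrier) xs →
    sumR R (map (λ z → f z - g z) xs) ≈ sumR R (map f xs) - sumR R (map g xs)
  sumR-map-minus f g xs = trans (sumR-map-+ f (λ z → - g z) xs) (+-congˡ (sumR-map-neg g xs))

  sumR-map-0# : ∀ {a} {A : Set a} (xs : List A) → sumR R (map (λ _ → 0#) xs) ≈ 0#
  sumR-map-0# []       = refl
  sumR-map-0# (z ∷ xs) = trans (+-identityˡ _) (sumR-map-0# xs)

  sumR-map-1# : ∀ {a} {A : Set a} (xs : List A) → sumR R (map (λ _ → 1#) xs) ≈ fromℕ R (length xs)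
  sumR-map-1# []       = refl
  sumR-map-1# (z ∷ xs) = +-congˡ (sumR-map-1# xs)

  minus-fromℕ-suc : ∀ a n → a - fromℕ R (suc n) ≈ (a - 1#) - fromℕ R n
  minus-fromℕ-suc a n = trans (+-congˡ (sym (-‿+-comm 1# (fromℕ R n)))) (sym (+-assoc a _ _))

  minus-0# : ∀ a → a - 0# ≈ a
  minus-0# a = trans (+-congˡ -0#≈0#) (+-identityʳ a)

  indicator : ∀ {p} → Fin p → Fin p → Carrier
  indicator i a = if does (i ≟ a) then 1# else 0#

  sumR-indicator : ∀ {p} (i : Fin p) → sumR R (map (indicator i) (allFin p)) ≈ 1#
  sumR-indicator {suc p} Fin.zero = begin
    sumR R (map (indicator Fin.zero) (allFin (suc p)))
      ≡⟨ ≡.cong (sumR R) (map-allFin-suc {n = p} (indicator Fin.zero)) ⟩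
    1# + sumR R (map (λ _ → 0#) (allFin p)) ≈⟨ +-congˡ (sumR-map-0# (allFin p)) ⟩
    1# + 0#                                 ≈⟨ +-identityʳ 1# ⟩
    1#                                      ∎
  sumR-indicator {suc p} (Fin.suc i) = begin
    sumR R (map (indicator (Fin.suc i)) (allFin (suc p)))
      ≡⟨ ≡.cong (sumR R) (map-allFin-suc {n = p} (indicator (Fin.suc i))) ⟩
    0# + sumR R (map (indicator i) (allFin p)) ≈⟨ +-identityˡ _ ⟩
    sumR R (map (indicator i) (allFin p))      ≈⟨ sumR-indicator i ⟩
    1#                                         ∎

  decrementAt : ∀ {p} → (Fin p → Carrier) → Fin p → Fin p → Carrier
  decrementAt x i a = x a - indicator i a

  sumR-decrementAt : ∀ {p} (x : Fin p → Carrier) (i : Fin p) →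
    sumR R (map (decrementAt x i) (allFin p)) ≈ sumR R (map x (allFin p)) - 1#
  sumR-decrementAt {p} x i =
    trans (sumR-map-minus x (indicator i) (allFin p)) (+-congˡ (-‿cong (sumR-indicator i)))

  sumR-minus-1# : ∀ {p} (x : Fin p → Carrier) →
    sumR R (map (λ a → x a - 1#) (allFin p)) ≈ sumR R (map x (allFin p)) - fromℕ R p
  sumR-minus-1# {p} x = begin
    sumR R (map (λ a → x a - 1#) (allFin p))
      ≈⟨ sumR-map-minus x (λ _ → 1#) (allFin p) ⟩
    sumR R (map x (allFin p)) - sumR R (map (λ _ → 1#) (allFin p))
      ≈⟨ +-congˡ (-‿cong (sumR-map-1# (allFin p))) ⟩
    sumR R (map x (allFin p)) - fromℕ R (length (allFin p))
      ≡⟨ ≡.cong (λ n → sumR R (map x (allFin p)) - fromℕ R n) (length-tabulate {n = p} id) ⟩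
    sumR R (map x (allFin p)) - fromℕ R p ∎

  productX-cons : ∀ {p s} (x : Fin p → Carrier) (i : Fin p) (v : Vec (Fin p) s) →
    productX R x (i ∷ᵥ v) ≈ (x i - 1#) * productX R (decrementAt x i) v
  productX-cons {s = s} x i v = begin
    productX R x (i ∷ᵥ v)
      ≡⟨ ≡.cong (prodR R) (map-allFin-suc {n = s} factor) ⟩
    factor Fin.zero * prodR R (map (factor ∘ Fin.suc) (allFin s))
      ≈⟨ *-cong first-factor (prodR-cong later-factor (allFin s)) ⟩
    (x i - 1#) * productX R (decrementAt x i) v ∎
    where
    factor : Fin (suc s) → Carrier
    factor j = x (lookup (i ∷ᵥ v) j) - fromℕ R (nCount (i ∷ᵥ v) j)

    first-factor : factor Fin.zero ≈ x i - 1#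
    first-factor rewrite nCount-cons-zero i v = +-congˡ (-‿cong (+-identityʳ 1#))

    later-factor : ∀ j →
      factor (Fin.suc j) ≈ decrementAt x i (lookup v j) - fromℕ R (nCount v j)
    later-factor j rewrite nCount-cons-suc i v j with does (i ≟ lookup v j)
    ... | true  = minus-fromℕ-suc _ (nCount v j)
    ... | false = +-congʳ (sym (minus-0# _))

  falling-cong : ∀ {a b} → a ≈ b → ∀ s → falling R a s ≈ falling R b s
  falling-cong a≈b s = prodR-cong (λ _ → +-congʳ a≈b) (allFin s)

  falling-suc : ∀ a s → falling R a (suc s) ≈ a * falling R (a - 1#) s
  falling-suc a s = begin
    falling R a (suc s)
      ≡⟨ ≡.cong (prodR R) (map-allFin-suc {n = s} (λ t → a - fromℕ R (toℕ t))) ⟩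
    (a - 0#) * prodR R (map (λ t → a - fromℕ R (suc (toℕ t))) (allFin s))
      ≈⟨ *-cong (minus-0# a) (prodR-cong (λ t → minus-fromℕ-suc a (toℕ t)) (allFin s)) ⟩
    a * falling R (a - 1#) s ∎

  sumR-productX : ∀ p s (x : Fin p → Carrier) →
    sumR R (map (productX R x) (tuples p s)) ≈ falling R (sumR R (map x (allFin p)) - fromℕ R p) s
  sumR-productX p zero    x = +-identityʳ 1#
  sumR-productX p (suc s) x = begin
    sumR R (map (productX R x) (tuples p (suc s)))
      ≈⟨ sumR-concatMap (productX R x) (λ i → map (i ∷ᵥ_) (tuples p s)) (allFin p) ⟩
    sumR R (map (λ i → sumR R (map (productX R x) (map (i ∷ᵥ_) (tuples p s)))) (allFin p))
      ≈⟨ sumR-cong first-index (allFin p) ⟩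
    sumR R (map (λ i → (x i - 1#) * falling R (K - 1#) s) (allFin p))
      ≈⟨ sumR-*ʳ (falling R (K - 1#) s) (λ i → x i - 1#) (allFin p) ⟩
    sumR R (map (λ i → x i - 1#) (allFin p)) * falling R (K - 1#) s
      ≈⟨ *-congʳ (sumR-minus-1# x) ⟩
    K * falling R (K - 1#) s
      ≈⟨ falling-suc K s ⟨
    falling R K (suc s) ∎
    where
    S = sumR R (map x (allFin p))
    K = S - fromℕ R p

    first-index : ∀ i → sumR R (map (productX R x) (map (i ∷ᵥ_) (tuples p s))) ≈
                        (x i - 1#) * falling R (K - 1#) s
    first-index i = begin
      sumR R (map (productX R x) (map (i ∷ᵥ_) (tuples p s)))
        ≡⟨ ≡.cong (sumR R) (map-∘ (tuples p s)) ⟨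
      sumR R (map (λ v → productX R x (i ∷ᵥ v)) (tuples p s))
        ≈⟨ sumR-cong (productX-cons x i) (tuples p s) ⟩
      sumR R (map (λ v → (x i - 1#) * productX R (decrementAt x i) v) (tuples p s))
        ≈⟨ sumR-*ˡ (x i - 1#) (productX R (decrementAt x i)) (tuples p s) ⟩
      (x i - 1#) * sumR R (map (productX R (decrementAt x i)) (tuples p s))
        ≈⟨ *-congˡ (sumR-productX p s (decrementAt x i)) ⟩
      (x i - 1#) * falling R (sumR R (map (decrementAt x i) (allFin p)) - fromℕ R p) s
        ≈⟨ *-congˡ (falling-cong (trans (+-congʳ (sumR-decrementAt x i)) (xy∙z≈xz∙y S _ _)) s) ⟩
      (x i - 1#) * falling R (K - 1#) s ∎

mainTheorem4 : ∀ {c ℓ} (R : CommutativeRing c ℓ) →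
    let open CommutativeRing R in
    (p s : ℕ) → 1 ≤ s → (x : Fin p → Carrier) (k : Carrier) →
    sumR R (map x (allFin p)) ≈ k →
    sumR R (map (productX R x) (tuples p s)) ≈ falling R (k - fromℕ R p) s
mainTheorem4 R p s _ x k Σx≈k =
  trans (sumR-productX R p s x) (falling-cong R (+-congʳ Σx≈k) s)
  where open CommutativeRing R
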